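{- Let $G=(V,E)$ be an undirected connected multi-graph, $S\subseteq V$ a Steiner set, and $\lambda_S$ the capacity of an $S$-mincut. Let $C_1,C_2,C_3$ be three Steiner cuts of capacity $\lambda_S+1$. Define $V_a=C_1\cap\overline{C_2}\cap\overline{C_3}$, $V_b=\overline{C_1}\cap C_2\cap\overline{C_3}$, $V_c=\overline{C_1}\cap\overline{C_2}\cap C_3$, $V_{ab}=C_1\cap C_2\cap\overline{C_3}$, $V_{bc}=\overline{C_1}\cap C_2\cap C_3$, $V_{ac}=C_1\cap\overline{C_2}\cap C_3$, $V_{abc}=C_1\cap C_2\cap C_3$, $V_{\Phi}=\overline{C_1\cup C_2\cup C_3}$ (with $V_{ba}=V_{ab}$, $V_{cb}=V_{bc}$, $V_{ca}=V_{ac}$). Suppose there are Steiner vertices $a,b,c\in S$ with $a\in V_a$, $b\in V_b$, $c\in V_c$. Then: (1) $c(C_1\cap C_2\cap C_3)\le 3$. (2) For any $(\lambda_S+1)$-connectivity class $\mathcal{W}$ and any integer $k\in[0,3]$, if (i) there is a vertex $u\in V_{\Phi}\cap\mathcal{W}$ and (ii) exactly $k$ of the three sets $V_a,V_b,V_c$ contain a vertex of $\mathcal{W}$, then $c(C_1\cap C_2\cap C_3)\le 3-k$. (3) Let $x,y,z\in\{a,b,c\}$ be pairwise distinct. Vertices of $V_{xy}$ are adjacent to vertices of $V_{xy}$, $V_x$ and $V_y$; moreover, there are at most two edges between $V_{xy}$ and $V\setminus(V_x\cup V_y\cup V_{xy})=V_z\cup V_{xz}\cup V_{yz}\cup V_{xyz}\cup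 V_{\Phi}$.
   Context: For $X\subseteq V$, $\overline{X}=V\setminus X$ and $c(X)$ is the number of edges (with multiplicity) with exactly one endpoint in $X$ (so $c(\emptyset)=0$). A Steiner cut is a set $C\subset V$ with some vertex of $S$ in $C$ and some vertex of $S$ outside $C$; an $S$-mincut is a Steiner cut of minimum capacity $\lambda_S$. Two vertices $u,v$ are related iff no $S$-mincut separates them (i.e. contains exactly one of them); the equivalence classes of this relation are the $(\lambda_S+1)$-connectivity classes. -}

module Defs where

open import Data.Nat using (ℕ; zero; suc; _+_; _≤_)
open import Data.Bool using (Bool; true; false; _xor_; _∧_; _∨_; not)
open import Data.Fin using (Fin)
open import Data.Fin.Subset using (Subset; _∈_; _∉_; _∩_; _∪_; ∁; Nonempty)
open import Data.Fin.Subset.Properties using (nonempty?)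
open import Data.Vec using (lookup)
open import Data.List using (List; []; _∷_)
open import Data.Product using (_×_; _,_; ∃; ∃-syntax)
open import Relation.Nullary using (¬_)
open import Relation.Nullary.Decidable using (⌊_⌋)
open import Function.Bundles using (_⇔_)
open import Relation.Binary.PropositionalEquality using (_≡_)
import Data.List.Membership.Propositional as L

-- A finite undirected multigraph on vertex set V = Fin n is given by a list
-- of edges (unordered pairs, stored as ordered pairs; repetitions = multiplicity).
Edges : ℕ → Set
Edges n = List (Fin n × Fin n)

countᵇ : {A : Set} → (A → Bool) → List A → ℕ
countᵇ p [] = 0
countᵇ p (x ∷ xs) with p x
... | true  = suc (countᵇ p xs)
... | false = countᵇ p xs

cap : ∀ {n} → Edges n → Subset n → ℕ
cap E X = countᵇ (λ { (u , v) → lookup X u xor lookup X v }) E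

edgesBetween : ∀ {n} → Edges n → Subset n → Subset n → ℕ
edgesBetween E A B =
  countᵇ (λ { (u , v) → (lookup A u ∧ lookup B v) ∨ (lookup B u ∧ lookup A v) }) E

data Reach {n} (E : Edges n) : Fin n → Fin n → Set where
  refl  : ∀ {u} → Reach E u u
  stepL : ∀ {u v w} → (u , v) L.∈ E → Reach E v w → Reach E u w
  stepR : ∀ {u v w} → (v , u) L.∈ E → Reach E v w → Reach E u w

Connected : ∀ {n} → Edges n → Set
Connected {n} E = ∀ (u v : Fin n) → Reach E u v

SteinerCut : ∀ {n} → Subset n → Subset n → Set
SteinerCut S C = (∃[ s ] (s ∈ S × s ∈ C)) × (∃[ t ] (t ∈ S × t ∉ C))

IsMincutValue : ∀ {n} → Edges n → Subset n → ℕ → Set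
IsMincutValue E S λS =
  (∃[ C ] (SteinerCut S C × cap E C ≡ λS))
  × (∀ C → SteinerCut S C → λS ≤ cap E C)

SMincut : ∀ {n} → Edges n → Subset n → Subset n → Set
SMincut E S C = SteinerCut S C × (∀ D → SteinerCut S D → cap E C ≤ cap E D)

Related : ∀ {n} → Edges n → Subset n → Fin n → Fin n → Set
Related E S u v = ∀ C → SMincut E S C → (u ∈ C ⇔ v ∈ C)

-- W is a (λ_S+1)-connectivity class: an equivalence class of Related.
IsConnClass : ∀ {n} → Edges n → Subset n → Subset n → Set
IsConnClass E S W = ∃[ w ] (∀ v → (v ∈ W ⇔ Related E S w v))

hits : ∀ {n} → Subset n → ℕ
hits X with ⌊ nonempty? X ⌋
... | true  = 1
... | false = 0

module Regions {n : ℕ} (C₁ C₂ C₃ : Subset n) where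
  Va Vb Vc Vab Vbc Vac Vabc VΦ : Subset n
  Va   = C₁ ∩ ∁ C₂ ∩ ∁ C₃
  Vb   = ∁ C₁ ∩ C₂ ∩ ∁ C₃
  Vc   = ∁ C₁ ∩ ∁ C₂ ∩ C₃
  Vab  = C₁ ∩ C₂ ∩ ∁ C₃
  Vbc  = ∁ C₁ ∩ C₂ ∩ C₃
  Vac  = C₁ ∩ ∁ C₂ ∩ C₃
  Vabc = C₁ ∩ C₂ ∩ C₃
  VΦ   = ∁ (C₁ ∪ C₂ ∪ C₃)

{-# OPTIONS --safe #-}
-- Every quantity in the theorem is a sum over the edges of a contribution that
-- depends only on which of C₁, C₂, C₃ contain the two endpoints. So inequalities
--   c(Va) + c(Vb) + c(Vc) + c(Vabc) ≤ c(C₁) + c(C₂) + c(C₃),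
--   c(Va) + c(Vb) + c(Vc) + c(C₃ ∖ Vabc) + 2 e(Vab, V ∖ (Va ∪ Vb ∪ Vab))
--     ≤ c(C₁) + c(C₂) + 2 c(C₃)
-- (and the permuted ones) hold edge by edge, which is decided over the 64 pairs of
-- membership patterns. The terminals a, b, c make Va, Vb, Vc and Cz ∖ Vabc
-- Steiner cuts, of capacity ≥ λS, while c(Cᵢ) = λS + 1; this gives c(Vabc) ≤ 3
-- and at most two edges leaving Vxy. For (2), a class W meeting VΦ and Vx is
-- split by the Steiner cut Vx, which is therefore no S-mincut: c(Vx) ≥ λS + 1.
module Submission where

open import Defs
open import Data.Bool using (Bool; true; false; _xor_; _∧_; _∨_; not)
import Data.Bool.Properties as Bool
open import Data.Fin using (Fin; zero; suc)
open import Data.Fin.Subset using (Subset; _∈_; _∉_; _⊆_; _∩_; _∪_; ∁; Nonempty)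
open import Data.Fin.Subset.Properties using (nonempty?; anySubset?; x∈p∩q⁻; x∈∁p⇒x∉p)
open import Data.List using (List; []; _∷_; map)
open import Data.List.Properties using (map-cong)
open import Data.Nat using (ℕ; suc; _+_; _*_; _∸_; _≤_; _<_; _≤?_; z≤n)
open import Data.Nat.ListAction using (sum)
open import Data.Nat.Properties
open import Data.Nat.Tactic.RingSolver using (solve-∀)
open import Data.Product using (_×_; _,_; ∃-syntax)
open import Data.Vec as Vec using (Vec; []; _∷_; lookup)
open import Data.Vec.Properties using (lookup-map; lookup-zipWith; []=⇒lookup; lookup⇒[]=)
open import Function.Base using (_∘_)
open import Function.Bundles using (_⇔_; Equivalence)
open import Relation.Nullary using (yes; no)
open import Relation.Nullary.Decidable using (Dec; True; map′; ¬?; _→-dec_; decidable-stable; toWitness)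
open import Relation.Unary using (Pred; Decidable)
open import Relation.Binary.PropositionalEquality

bit : Bool → ℕ
bit true  = 1
bit false = 0

module _ {A : Set} where

  countᵇ≡sum : (p : A → Bool) (xs : List A) → countᵇ p xs ≡ sum (map (bit ∘ p) xs)
  countᵇ≡sum p []       = refl
  countᵇ≡sum p (x ∷ xs) with p x
  ... | true  = cong suc (countᵇ≡sum p xs)
  ... | false = countᵇ≡sum p xs

  sum-map-0 : (xs : List A) → sum (map (λ _ → 0) xs) ≡ 0
  sum-map-0 []       = refl
  sum-map-0 (_ ∷ xs) = sum-map-0 xs

  sum-map-+ : (f g : A → ℕ) (xs : List A) →
              sum (map (λ x → f x + g x) xs) ≡ sum (map f xs) + sum (map g xs)
  sum-map-+ f g []       = refl
  sum-map-+ f g (x ∷ xs) = begin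
    f x + g x + sum (map (λ x → f x + g x) xs)    ≡⟨ cong (f x + g x +_) (sum-map-+ f g xs) ⟩
    f x + g x + (sum (map f xs) + sum (map g xs)) ≡⟨ +-interchange (f x) (g x) _ _ ⟩
    f x + sum (map f xs) + (g x + sum (map g xs)) ∎
    where
    open ≡-Reasoning
    +-interchange : ∀ a b c d → a + b + (c + d) ≡ a + c + (b + d)
    +-interchange = solve-∀

  sum-map-mono : {f g : A → ℕ} → (∀ x → f x ≤ g x) → (xs : List A) → sum (map f xs) ≤ sum (map g xs)
  sum-map-mono f≤g []       = z≤n
  sum-map-mono f≤g (x ∷ xs) = +-mono-≤ (f≤g x) (sum-map-mono f≤g xs)

allSubset? : ∀ {k ℓ} {P : Pred (Subset k) ℓ} → Decidable P → Dec (∀ ρ → P ρ)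
allSubset? P? = map′ (λ ∄¬P ρ → decidable-stable (P? ρ) (∄¬P ∘ (ρ ,_)))
                     (λ ∀P (ρ , ¬Pρ) → ¬Pρ (∀P ρ))
                     (¬? (anySubset? (¬? ∘ P?)))

infixr 7 _∩ᶠ_
infixr 6 _∪ᶠ_

data Formula (k : ℕ) : Set where
  var       : Fin k → Formula k
  ∁ᶠ        : Formula k → Formula k
  _∩ᶠ_ _∪ᶠ_ : Formula k → Formula k → Formula k

⟦_⟧ᵇ : ∀ {k} → Formula k → Subset k → Bool
⟦ var i  ⟧ᵇ ρ = lookup ρ i
⟦ ∁ᶠ φ   ⟧ᵇ ρ = not (⟦ φ ⟧ᵇ ρ)
⟦ φ ∩ᶠ ψ ⟧ᵇ ρ = ⟦ φ ⟧ᵇ ρ ∧ ⟦ ψ ⟧ᵇ ρ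
⟦ φ ∪ᶠ ψ ⟧ᵇ ρ = ⟦ φ ⟧ᵇ ρ ∨ ⟦ ψ ⟧ᵇ ρ

_⊨_ : ∀ {k} → Formula k → Formula k → Set
φ ⊨ ψ = ∀ ρ → ⟦ φ ⟧ᵇ ρ ≡ true → ⟦ ψ ⟧ᵇ ρ ≡ true

_⊨?_ : ∀ {k} (φ ψ : Formula k) → Dec (φ ⊨ ψ)
φ ⊨? ψ = allSubset? λ ρ → (⟦ φ ⟧ᵇ ρ Bool.≟ true) →-dec (⟦ ψ ⟧ᵇ ρ Bool.≟ true)

data EdgeCount (k : ℕ) : Set where
  cut     : Formula k → EdgeCount k
  between : Formula k → Formula k → EdgeCount k

-- ρ and σ are the membership patterns of the two endpoints of an edge (see profile).
weight : ∀ {k} → EdgeCount k → Subset k → Subset k → ℕ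
weight (cut φ)       ρ σ = bit (⟦ φ ⟧ᵇ ρ xor ⟦ φ ⟧ᵇ σ)
weight (between φ ψ) ρ σ = bit ((⟦ φ ⟧ᵇ ρ ∧ ⟦ ψ ⟧ᵇ σ) ∨ (⟦ ψ ⟧ᵇ ρ ∧ ⟦ φ ⟧ᵇ σ))

-- Three clauses rather than a fold, so that totals reduce to a + (b + c) without
-- a trailing + 0, the shape in which the inequalities below are stated.
totalWeight : ∀ {k} → List (EdgeCount k) → Subset k → Subset k → ℕ
totalWeight []               ρ σ = 0
totalWeight (m ∷ [])        ρ σ = weight m ρ σ
totalWeight (m ∷ ms@(_ ∷ _)) ρ σ = weight m ρ σ + totalWeight ms ρ σ

_≤ʷ_ : ∀ {k} → List (EdgeCount k) → List (EdgeCount k) → Set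
ms ≤ʷ ms′ = ∀ ρ σ → totalWeight ms ρ σ ≤ totalWeight ms′ ρ σ

_≤ʷ?_ : ∀ {k} (ms ms′ : List (EdgeCount k)) → Dec (ms ≤ʷ ms′)
ms ≤ʷ? ms′ = allSubset? λ ρ → allSubset? λ σ → totalWeight ms ρ σ ≤? totalWeight ms′ ρ σ

module Interpretation {n k : ℕ} (E : Edges n) (Cs : Vec (Subset n) k) where

  ⟦_⟧ : Formula k → Subset n
  ⟦ var i  ⟧ = lookup Cs i
  ⟦ ∁ᶠ φ   ⟧ = ∁ ⟦ φ ⟧
  ⟦ φ ∩ᶠ ψ ⟧ = ⟦ φ ⟧ ∩ ⟦ ψ ⟧
  ⟦ φ ∪ᶠ ψ ⟧ = ⟦ φ ⟧ ∪ ⟦ ψ ⟧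

  profile : Fin n → Subset k
  profile u = Vec.map (λ C → lookup C u) Cs

  lookup-⟦⟧ : ∀ φ u → lookup ⟦ φ ⟧ u ≡ ⟦ φ ⟧ᵇ (profile u)
  lookup-⟦⟧ (var i)  u = sym (lookup-map i (λ C → lookup C u) Cs)
  lookup-⟦⟧ (∁ᶠ φ)   u = trans (lookup-map u not ⟦ φ ⟧) (cong not (lookup-⟦⟧ φ u))
  lookup-⟦⟧ (φ ∩ᶠ ψ) u = trans (lookup-zipWith _∧_ u ⟦ φ ⟧ ⟦ ψ ⟧) (cong₂ _∧_ (lookup-⟦⟧ φ u) (lookup-⟦⟧ ψ u))
  lookup-⟦⟧ (φ ∪ᶠ ψ) u = trans (lookup-zipWith _∨_ u ⟦ φ ⟧ ⟦ ψ ⟧) (cong₂ _∨_ (lookup-⟦⟧ φ u) (lookup-⟦⟧ ψ u))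

  ⊨⇒⊆ : ∀ φ ψ → φ ⊨ ψ → ⟦ φ ⟧ ⊆ ⟦ ψ ⟧
  ⊨⇒⊆ φ ψ φ⊨ψ {u} u∈φ = lookup⇒[]= u ⟦ ψ ⟧ (begin
    lookup ⟦ ψ ⟧ u        ≡⟨ lookup-⟦⟧ ψ u ⟩
    ⟦ ψ ⟧ᵇ (profile u)    ≡⟨ φ⊨ψ (profile u) (trans (sym (lookup-⟦⟧ φ u)) ([]=⇒lookup u∈φ)) ⟩
    true                  ∎)
    where open ≡-Reasoning

  ⊆-by-profiles : ∀ φ ψ {_ : True (φ ⊨? ψ)} → ⟦ φ ⟧ ⊆ ⟦ ψ ⟧
  ⊆-by-profiles φ ψ {φ⊨ψ} = ⊨⇒⊆ φ ψ (toWitness φ⊨ψ)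

  ∉-by-profiles : ∀ φ ψ {_ : True (φ ⊨? ∁ᶠ ψ)} {u} → u ∈ ⟦ φ ⟧ → u ∉ ⟦ ψ ⟧
  ∉-by-profiles φ ψ {φ⊨∁ψ} = x∈∁p⇒x∉p ∘ ⊆-by-profiles φ (∁ᶠ ψ) {φ⊨∁ψ}

  count : EdgeCount k → ℕ
  count (cut φ)       = cap E ⟦ φ ⟧
  count (between φ ψ) = edgesBetween E ⟦ φ ⟧ ⟦ ψ ⟧

  total : List (EdgeCount k) → ℕ
  total []               = 0
  total (m ∷ [])         = count m
  total (m ∷ ms@(_ ∷ _)) = count m + total ms

  profileSum : (Subset k → Subset k → ℕ) → ℕ
  profileSum w = sum (map (λ (u , v) → w (profile u) (profile v)) E)

  count≡profileSum : ∀ m → count m ≡ profileSum (weight m)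
  count≡profileSum (cut φ) = trans (countᵇ≡sum _ E) (cong sum (map-cong
    (λ (u , v) → cong bit (cong₂ _xor_ (lookup-⟦⟧ φ u) (lookup-⟦⟧ φ v))) E))
  count≡profileSum (between φ ψ) = trans (countᵇ≡sum _ E) (cong sum (map-cong
    (λ (u , v) → cong bit (cong₂ _∨_ (cong₂ _∧_ (lookup-⟦⟧ φ u) (lookup-⟦⟧ ψ v))
                                     (cong₂ _∧_ (lookup-⟦⟧ ψ u) (lookup-⟦⟧ φ v)))) E))

  total≡profileSum : ∀ ms → total ms ≡ profileSum (totalWeight ms)
  total≡profileSum []               = sym (sum-map-0 E)
  total≡profileSum (m ∷ [])         = count≡profileSum m
  total≡profileSum (m ∷ ms@(_ ∷ _)) =
    trans (cong₂ _+_ (count≡profileSum m) (total≡profileSum ms)) (sym (sum-map-+ _ _ E))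

  total-mono : ∀ ms ms′ → ms ≤ʷ ms′ → total ms ≤ total ms′
  total-mono ms ms′ ms≤ms′ = begin
    total ms                      ≡⟨ total≡profileSum ms ⟩
    profileSum (totalWeight ms)   ≤⟨ sum-map-mono (λ (u , v) → ms≤ms′ (profile u) (profile v)) E ⟩
    profileSum (totalWeight ms′)  ≡⟨ total≡profileSum ms′ ⟨
    total ms′                     ∎
    where open ≤-Reasoning

  total-≤-by-profiles : ∀ ms ms′ {_ : True (ms ≤ʷ? ms′)} → total ms ≤ total ms′
  total-≤-by-profiles ms ms′ {ms≤ms′} = total-mono ms ms′ (toWitness ms≤ms′)

-- ⟦ va ⟧ is definitionally Regions.Va for the cuts C₁ ∷ C₂ ∷ C₃ ∷ [], and so on.
c₁ c₂ c₃ va vb vc vab vbc vac vabc vΦ c₁∖vabc c₂∖vabc c₃∖vabc : Formula 3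
c₁      = var zero
c₂      = var (suc zero)
c₃      = var (suc (suc zero))
va      = c₁ ∩ᶠ ∁ᶠ c₂ ∩ᶠ ∁ᶠ c₃
vb      = ∁ᶠ c₁ ∩ᶠ c₂ ∩ᶠ ∁ᶠ c₃
vc      = ∁ᶠ c₁ ∩ᶠ ∁ᶠ c₂ ∩ᶠ c₃
vab     = c₁ ∩ᶠ c₂ ∩ᶠ ∁ᶠ c₃
vbc     = ∁ᶠ c₁ ∩ᶠ c₂ ∩ᶠ c₃
vac     = c₁ ∩ᶠ ∁ᶠ c₂ ∩ᶠ c₃
vabc    = c₁ ∩ᶠ c₂ ∩ᶠ c₃
vΦ      = ∁ᶠ (c₁ ∪ᶠ c₂ ∪ᶠ c₃)
c₁∖vabc = c₁ ∩ᶠ ∁ᶠ (c₂ ∩ᶠ c₃)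
c₂∖vabc = c₂ ∩ᶠ ∁ᶠ (c₁ ∩ᶠ c₃)
c₃∖vabc = c₃ ∩ᶠ ∁ᶠ (c₁ ∩ᶠ c₂)

module ThreeCuts {n : ℕ} (E : Edges n) (C₁ C₂ C₃ : Subset n) where
  open Regions C₁ C₂ C₃
  open Interpretation E (C₁ ∷ C₂ ∷ C₃ ∷ []) public

  pieces-≤-cuts : cap E Va + (cap E Vb + (cap E Vc + cap E Vabc)) ≤ cap E C₁ + (cap E C₂ + cap E C₃)
  pieces-≤-cuts = total-≤-by-profiles
    (cut va ∷ cut vb ∷ cut vc ∷ cut vabc ∷ []) (cut c₁ ∷ cut c₂ ∷ cut c₃ ∷ [])

  Vab-leak-≤ : let e = edgesBetween E Vab (∁ (Va ∪ Vb ∪ Vab)) in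
    cap E Va + (cap E Vb + (cap E Vc + (cap E (C₃ ∩ ∁ (C₁ ∩ C₂)) + (e + e))))
      ≤ cap E C₁ + (cap E C₂ + (cap E C₃ + cap E C₃))
  Vab-leak-≤ = total-≤-by-profiles
    (cut va ∷ cut vb ∷ cut vc ∷ cut c₃∖vabc ∷ between vab rest ∷ between vab rest ∷ [])
    (cut c₁ ∷ cut c₂ ∷ cut c₃ ∷ cut c₃ ∷ [])
    where rest = ∁ᶠ (va ∪ᶠ vb ∪ᶠ vab)

  Vbc-leak-≤ : let e = edgesBetween E Vbc (∁ (Vb ∪ Vc ∪ Vbc)) in
    cap E Va + (cap E Vb + (cap E Vc + (cap E (C₁ ∩ ∁ (C₂ ∩ C₃)) + (e + e))))
      ≤ cap E C₁ + (cap E C₂ + (cap E C₃ + cap E C₁))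
  Vbc-leak-≤ = total-≤-by-profiles
    (cut va ∷ cut vb ∷ cut vc ∷ cut c₁∖vabc ∷ between vbc rest ∷ between vbc rest ∷ [])
    (cut c₁ ∷ cut c₂ ∷ cut c₃ ∷ cut c₁ ∷ [])
    where rest = ∁ᶠ (vb ∪ᶠ vc ∪ᶠ vbc)

  Vac-leak-≤ : let e = edgesBetween E Vac (∁ (Va ∪ Vc ∪ Vac)) in
    cap E Va + (cap E Vb + (cap E Vc + (cap E (C₂ ∩ ∁ (C₁ ∩ C₃)) + (e + e))))
      ≤ cap E C₁ + (cap E C₂ + (cap E C₃ + cap E C₂))
  Vac-leak-≤ = total-≤-by-profiles
    (cut va ∷ cut vb ∷ cut vc ∷ cut c₂∖vabc ∷ between vac rest ∷ between vac rest ∷ [])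
    (cut c₁ ∷ cut c₂ ∷ cut c₃ ∷ cut c₂ ∷ [])
    where rest = ∁ᶠ (va ∪ᶠ vc ∪ᶠ vac)

three-budget : ∀ {l x y z A B C D} → l + x ≤ A → l + y ≤ B → l + z ≤ C →
               A + (B + (C + D)) ≤ suc l + (suc l + suc l) → D ≤ 3 ∸ (x + y + z)
three-budget {l} {x} {y} {z} {A} {B} {C} {D} lx≤A ly≤B lz≤C sum≤ =
  m+n≤o⇒m≤o∸n D (+-cancelˡ-≤ (3 * l) _ _ (begin
    3 * l + (D + (x + y + z))      ≡⟨ lhs l x y z D ⟩
    l + x + (l + y + (l + z + D))  ≤⟨ +-mono-≤ lx≤A (+-mono-≤ ly≤B (+-monoˡ-≤ D lz≤C)) ⟩
    A + (B + (C + D))              ≤⟨ sum≤ ⟩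
    suc l + (suc l + suc l)        ≡⟨ rhs l ⟩
    3 * l + 3                      ∎))
  where
  open ≤-Reasoning
  lhs : ∀ l x y z D → 3 * l + (D + (x + y + z)) ≡ l + x + (l + y + (l + z + D))
  lhs = solve-∀
  rhs : ∀ l → suc l + (suc l + suc l) ≡ 3 * l + 3
  rhs = solve-∀

four-budget : ∀ {l A B C D e} → l ≤ A → l ≤ B → l ≤ C → l ≤ D →
              A + (B + (C + (D + (e + e)))) ≤ suc l + (suc l + (suc l + suc l)) → e ≤ 2
four-budget {l} {A} {B} {C} {D} {e} l≤A l≤B l≤C l≤D sum≤ =
  *-cancelˡ-≤ 2 (+-cancelˡ-≤ (4 * l) _ _ (begin
    4 * l + 2 * e                        ≡⟨ lhs l e ⟩
    l + (l + (l + (l + (e + e))))        ≤⟨ +-mono-≤ l≤A (+-mono-≤ l≤B (+-mono-≤ l≤C (+-monoˡ-≤ (e + e) l≤D))) ⟩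
    A + (B + (C + (D + (e + e))))        ≤⟨ sum≤ ⟩
    suc l + (suc l + (suc l + suc l))    ≡⟨ rhs l ⟩
    4 * l + 2 * 2                        ∎))
  where
  open ≤-Reasoning
  lhs : ∀ l e → 4 * l + 2 * e ≡ l + (l + (l + (l + (e + e))))
  lhs = solve-∀
  rhs : ∀ l → suc l + (suc l + (suc l + suc l)) ≡ 4 * l + 2 * 2
  rhs = solve-∀

+hits-≤ : ∀ {n m k} {X : Subset n} → m ≤ k → (Nonempty X → m < k) → m + hits X ≤ k
+hits-≤ {X = X} m≤k nonempty⇒m<k with nonempty? X
... | yes X≠∅ = ≤-trans (≤-reflexive (+-comm _ 1)) (nonempty⇒m<k X≠∅)
... | no  _   = ≤-trans (≤-reflexive (+-identityʳ _)) m≤k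

module _ {n : ℕ} (E : Edges n) {S : Subset n} where

  SMincut-keeps-class-together : ∀ {W R x y} → IsConnClass E S W → x ∈ W → y ∈ W → SMincut E S R → x ∈ R → y ∈ R
  SMincut-keeps-class-together {W} {R} (w , ∈W⇔related) x∈W y∈W R-min =
    Equivalence.to (w∈R⇔ y∈W) ∘ Equivalence.from (w∈R⇔ x∈W)
    where
    w∈R⇔ : ∀ {v} → v ∈ W → (w ∈ R ⇔ v ∈ R)
    w∈R⇔ {v} v∈W = Equivalence.to (∈W⇔related v) v∈W R R-min

  λ+hits-≤-cap : ∀ {λS W R y} → (∀ C → SteinerCut S C → λS ≤ cap E C) →
                 IsConnClass E S W → y ∈ W → y ∉ R → SteinerCut S R → λS + hits (R ∩ W) ≤ cap E R
  λ+hits-≤-cap {λS} {W} {R} lower W-class y∈W y∉R R-steiner =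
    +hits-≤ λS≤capR λ (x , x∈R∩W) → ≤∧≢⇒< λS≤capR λ λS≡capR →
      let (x∈R , x∈W) = x∈p∩q⁻ R W x∈R∩W in
      y∉R (SMincut-keeps-class-together W-class x∈W y∈W (R-steiner , mincut λS≡capR) x∈R)
    where
    λS≤capR = lower R R-steiner
    mincut : λS ≡ cap E R → ∀ D → SteinerCut S D → cap E R ≤ cap E D
    mincut λS≡capR D D-steiner = subst (_≤ cap E D) λS≡capR (lower D D-steiner)

module SteinerTriple
  {n : ℕ} (E : Edges n) {S : Subset n} {λS : ℕ}
  (lower : ∀ C → SteinerCut S C → λS ≤ cap E C)
  {C₁ C₂ C₃ : Subset n} (cap₁ : cap E C₁ ≡ suc λS) (cap₂ : cap E C₂ ≡ suc λS) (cap₃ : cap E C₃ ≡ suc λS)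
  {a b c : Fin n} (a∈S : a ∈ S) (b∈S : b ∈ S) (c∈S : c ∈ S)
  (a∈Va : a ∈ Regions.Va C₁ C₂ C₃) (b∈Vb : b ∈ Regions.Vb C₁ C₂ C₃) (c∈Vc : c ∈ Regions.Vc C₁ C₂ C₃)
  where
  open Regions C₁ C₂ C₃
  open ThreeCuts E C₁ C₂ C₃

  Va-steiner : SteinerCut S Va
  Va-steiner = (a , a∈S , a∈Va) , (b , b∈S , ∉-by-profiles vb va b∈Vb)

  Vb-steiner : SteinerCut S Vb
  Vb-steiner = (b , b∈S , b∈Vb) , (a , a∈S , ∉-by-profiles va vb a∈Va)

  Vc-steiner : SteinerCut S Vc
  Vc-steiner = (c , c∈S , c∈Vc) , (a , a∈S , ∉-by-profiles va vc a∈Va)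

  C₁∖Vabc-steiner : SteinerCut S (C₁ ∩ ∁ (C₂ ∩ C₃))
  C₁∖Vabc-steiner = (a , a∈S , ⊆-by-profiles va c₁∖vabc a∈Va) , (b , b∈S , ∉-by-profiles vb c₁∖vabc b∈Vb)

  C₂∖Vabc-steiner : SteinerCut S (C₂ ∩ ∁ (C₁ ∩ C₃))
  C₂∖Vabc-steiner = (b , b∈S , ⊆-by-profiles vb c₂∖vabc b∈Vb) , (a , a∈S , ∉-by-profiles va c₂∖vabc a∈Va)

  C₃∖Vabc-steiner : SteinerCut S (C₃ ∩ ∁ (C₁ ∩ C₂))
  C₃∖Vabc-steiner = (c , c∈S , ⊆-by-profiles vc c₃∖vabc c∈Vc) , (a , a∈S , ∉-by-profiles va c₃∖vabc a∈Va)

  pieces-budget : cap E Va + (cap E Vb + (cap E Vc + cap E Vabc)) ≤ suc λS + (suc λS + suc λS)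
  pieces-budget = ≤-trans pieces-≤-cuts (≤-reflexive (cong₂ _+_ cap₁ (cong₂ _+_ cap₂ cap₃)))

  cap-Vabc-≤ : cap E Vabc ≤ 3
  cap-Vabc-≤ = three-budget (lower₀ Va-steiner) (lower₀ Vb-steiner) (lower₀ Vc-steiner) pieces-budget
    where
    lower₀ : ∀ {C} → SteinerCut S C → λS + 0 ≤ cap E C
    lower₀ C-steiner = ≤-trans (≤-reflexive (+-identityʳ λS)) (lower _ C-steiner)

  cap-Vabc-≤-3∸hits : ∀ {W u} → IsConnClass E S W → u ∈ VΦ → u ∈ W →
    cap E Vabc ≤ 3 ∸ (hits (Va ∩ W) + hits (Vb ∩ W) + hits (Vc ∩ W))
  cap-Vabc-≤-3∸hits W-class u∈VΦ u∈W = three-budget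
    (λ+hits-≤-cap E lower W-class u∈W (∉-by-profiles vΦ va u∈VΦ) Va-steiner)
    (λ+hits-≤-cap E lower W-class u∈W (∉-by-profiles vΦ vb u∈VΦ) Vb-steiner)
    (λ+hits-≤-cap E lower W-class u∈W (∉-by-profiles vΦ vc u∈VΦ) Vc-steiner)
    pieces-budget

  leak-budget : ∀ C {D e} → cap E C ≡ suc λS → SteinerCut S D →
                cap E Va + (cap E Vb + (cap E Vc + (cap E D + (e + e))))
                  ≤ cap E C₁ + (cap E C₂ + (cap E C₃ + cap E C)) → e ≤ 2
  leak-budget C capC D-steiner sum≤ =
    four-budget (lower _ Va-steiner) (lower _ Vb-steiner) (lower _ Vc-steiner) (lower _ D-steiner)
      (≤-trans sum≤ (≤-reflexive (cong₂ _+_ cap₁ (cong₂ _+_ cap₂ (cong₂ _+_ cap₃ capC)))))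

theorem36 :
    ∀ {n : ℕ} (E : Edges n) (S : Subset n) (λS : ℕ) (C₁ C₂ C₃ : Subset n) (a b c : Fin n) →
    Connected E →
    IsMincutValue E S λS →
    SteinerCut S C₁ → cap E C₁ ≡ suc λS →
    SteinerCut S C₂ → cap E C₂ ≡ suc λS →
    SteinerCut S C₃ → cap E C₃ ≡ suc λS →
    a ∈ S → b ∈ S → c ∈ S →
    a ∈ Regions.Va C₁ C₂ C₃ → b ∈ Regions.Vb C₁ C₂ C₃ → c ∈ Regions.Vc C₁ C₂ C₃ →
    -- (1)
    (cap E (C₁ ∩ C₂ ∩ C₃) ≤ 3)
    -- (2)
    × (∀ (W : Subset n) (k : ℕ) → IsConnClass E S W → k ≤ 3 →
         (∃[ u ] (u ∈ Regions.VΦ C₁ C₂ C₃ × u ∈ W)) →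
         hits (Regions.Va C₁ C₂ C₃ ∩ W) + hits (Regions.Vb C₁ C₂ C₃ ∩ W)
           + hits (Regions.Vc C₁ C₂ C₃ ∩ W) ≡ k →
         cap E (C₁ ∩ C₂ ∩ C₃) ≤ 3 ∸ k)
    -- (3) for {x,y} = {a,b}, {b,c}, {a,c}
    × (edgesBetween E (Regions.Vab C₁ C₂ C₃)
         (∁ (Regions.Va C₁ C₂ C₃ ∪ Regions.Vb C₁ C₂ C₃ ∪ Regions.Vab C₁ C₂ C₃)) ≤ 2)
    × (edgesBetween E (Regions.Vbc C₁ C₂ C₃)
         (∁ (Regions.Vb C₁ C₂ C₃ ∪ Regions.Vc C₁ C₂ C₃ ∪ Regions.Vbc C₁ C₂ C₃)) ≤ 2)
    × (edgesBetween E (Regions.Vac C₁ C₂ C₃)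
         (∁ (Regions.Va C₁ C₂ C₃ ∪ Regions.Vc C₁ C₂ C₃ ∪ Regions.Vac C₁ C₂ C₃)) ≤ 2)
theorem36 E S λS C₁ C₂ C₃ a b c _ (_ , lower) _ cap₁ _ cap₂ _ cap₃ a∈S b∈S c∈S a∈Va b∈Vb c∈Vc =
    cap-Vabc-≤
  , (λ { W k W-class _ (u , u∈VΦ , u∈W) refl → cap-Vabc-≤-3∸hits W-class u∈VΦ u∈W })
  , leak-budget C₃ cap₃ C₃∖Vabc-steiner Vab-leak-≤
  , leak-budget C₁ cap₁ C₁∖Vabc-steiner Vbc-leak-≤
  , leak-budget C₂ cap₂ C₂∖Vabc-steiner Vac-leak-≤
  where
  open ThreeCuts E C₁ C₂ C₃
  open SteinerTriple E lower cap₁ cap₂ cap₃ a∈S b∈S c∈S a∈Va b∈Vb c∈Vc
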